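{- Let $G$ be a 3-colorable co-bridge-free prismatic graph, and suppose that, for some 3-coloring $(A,B,C)$ of $G$, the 3-colored graph $(G,A,B,C)$ admits a worn 2-chain decomposition $(G_1,A_1,B_1,C_1),(G_2,A_2,B_2,C_2)$. If one of $G_1,G_2$ has two vertex-disjoint triangles, then the other one either has at most $9$ vertices or has no triangle.
   Context: A triangle is a set of three pairwise adjacent vertices; $G$ is prismatic if for every triangle $T$ every vertex not in $T$ has exactly one neighbor in $T$. The co-bridge is $C_4+2K_1$; co-bridge-free means no induced co-bridge. A 3-colored graph is a quadruple $(G,A,B,C)$ with $A,B,C$ stable sets partitioning $V(G)$. For $n\ge1$, a worn $n$-chain decomposition of a 3-colored graph $(G,A,B,C)$ is a sequence of 3-colored prismatic graphs $(G_i,A_i,B_i,C_i)$, $1\le i\le n$, with $V(G_1),\dots,V(G_n)$ nonempty and pairwise disjoint, $V(G)=\bigcup_iV(G_i)$, $A=\bigcup_iA_i$, $B=\bigcup_iB_i$, $C=\bigcup_iC_i$, such that: (W1) $G[V(G_i)]=G_i$ for each $i$; (W2) for $1\le i<j\le n$, $A_i$ is anticomplete to $V(G_j)\setminus B_j$, $B_i$ is anticomplete to $V(G_j)\setminus C_j$, and $C_i$ is anticomplete to $V(G_j)\setminus A_j$; (W3) for $1\le i<j\le n$, if $u\in A_i$ and $v\in B_j$ are non-adjacent then neither $u$ nor $v$ is in a triangle (of $G$), and the same holds for $u\in B_i,v\in C_j$ and for $u\in C_i,v\in A_j$. ("Anticomplete" means no edges between the sets.) -}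

module Defs where

open import Data.Nat using (ℕ; zero; suc; _+_; _≤_)
open import Data.Unit using (⊤)
open import Data.Bool using (Bool; true; false)
open import Data.Fin using (Fin; zero; suc)
open import Data.Fin.Properties using (_≟_)
open import Data.List using (length; filter)
open import Data.List using () renaming (List to L)
open import Data.Product using (Σ; ∃; _×_; _,_)
open import Data.Sum using (_⊎_)
open import Relation.Nullary using (¬_)
open import Relation.Binary.PropositionalEquality using (_≡_; _≢_)
open import Function.Definitions using (Injective)
open import Data.List using (allFin)

record Graph (n : ℕ) : Set where
  field
    adj   : Fin n → Fin n → Bool
    sym   : ∀ u v → adj u v ≡ adj v u
    irrefl : ∀ v → adj v v ≡ false
open Graph public

module _ {n : ℕ} (G : Graph n) where

  Adj : Fin n → Fin n → Set
  Adj u v = adj G u v ≡ true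

  NonAdj : Fin n → Fin n → Set
  NonAdj u v = adj G u v ≡ false

  -- a triangle all of whose vertices satisfy P (three pairwise adjacent vertices;
  -- adjacency is irreflexive, so they are automatically distinct)
  TriangleIn : (Fin n → Set) → Fin n → Fin n → Fin n → Set
  TriangleIn P a b c = P a × P b × P c × Adj a b × Adj b c × Adj a c

  Triangle : Fin n → Fin n → Fin n → Set
  Triangle a b c = TriangleIn (λ _ → ⊤) a b c

  InTriangle : Fin n → Set
  InTriangle v = Σ (Fin n) λ b → Σ (Fin n) λ c → Triangle v b c

  b2n : Bool → ℕ
  b2n true = 1
  b2n false = 0

  PrismaticOn : (Fin n → Set) → Set
  PrismaticOn P = ∀ a b c → TriangleIn P a b c → ∀ v → P v →
    v ≢ a → v ≢ b → v ≢ c →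
    b2n (adj G v a) + b2n (adj G v b) + b2n (adj G v c) ≡ 1

  Prismatic : Set
  Prismatic = PrismaticOn (λ _ → ⊤)

  HasTriangleIn : (Fin n → Set) → Set
  HasTriangleIn P = Σ (Fin n) λ a → Σ (Fin n) λ b → Σ (Fin n) λ c → TriangleIn P a b c

  TwoDisjointTrianglesIn : (Fin n → Set) → Set
  TwoDisjointTrianglesIn P =
    Σ (Fin n) λ a₁ → Σ (Fin n) λ b₁ → Σ (Fin n) λ c₁ →
    Σ (Fin n) λ a₂ → Σ (Fin n) λ b₂ → Σ (Fin n) λ c₂ →
    TriangleIn P a₁ b₁ c₁ × TriangleIn P a₂ b₂ c₂ ×
    (a₁ ≢ a₂ × a₁ ≢ b₂ × a₁ ≢ c₂) ×
    (b₁ ≢ a₂ × b₁ ≢ b₂ × b₁ ≢ c₂) ×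
    (c₁ ≢ a₂ × c₁ ≢ b₂ × c₁ ≢ c₂)

-- The co-bridge C4 + 2K1 on Fin 6: vertices 0-1-2-3-0 form a C4; 4, 5 isolated.
cobridgeAdj : Fin 6 → Fin 6 → Bool
cobridgeAdj zero (suc zero) = true
cobridgeAdj (suc zero) zero = true
cobridgeAdj (suc zero) (suc (suc zero)) = true
cobridgeAdj (suc (suc zero)) (suc zero) = true
cobridgeAdj (suc (suc zero)) (suc (suc (suc zero))) = true
cobridgeAdj (suc (suc (suc zero))) (suc (suc zero)) = true
cobridgeAdj (suc (suc (suc zero))) zero = true
cobridgeAdj zero (suc (suc (suc zero))) = true
cobridgeAdj _ _ = false

HasInducedCobridge : {n : ℕ} → Graph n → Set
HasInducedCobridge {n} G =
  Σ (Fin 6 → Fin n) λ f → Injective _≡_ _≡_ f × (∀ i j → adj G (f i) (f j) ≡ cobridgeAdj i j)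

CobridgeFree : {n : ℕ} → Graph n → Set
CobridgeFree G = ¬ HasInducedCobridge G

data Colour : Set where
  A B C : Colour

next : Colour → Colour
next A = B
next B = C
next C = A

Is3Colouring : {n : ℕ} → Graph n → (Fin n → Colour) → Set
Is3Colouring {n} G col = ∀ u v → Adj G u v → col u ≢ col v

pieceSize : {n : ℕ} → (Fin n → Fin 2) → Fin 2 → ℕ
pieceSize {n} part i = length (filter (λ v → part v ≟ i) (allFin n))

-- The pieces are V(G₁) = part⁻¹(0), V(G₂) = part⁻¹(1) (disjoint, covering V(G));
-- by (W1) Gᵢ = G[V(Gᵢ)], and Aᵢ = A ∩ V(Gᵢ) etc. (forced by A = A₁ ∪ A₂, Aᵢ ⊆ V(Gᵢ)).
record Worn2Chain {n : ℕ} (G : Graph n) (col : Fin n → Colour) (part : Fin n → Fin 2) : Set where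
  field
    nonempty   : ∀ i → Σ (Fin n) λ v → part v ≡ i
    prismatic  : ∀ i → PrismaticOn G (λ v → part v ≡ i)
    W2 : ∀ u v → part u ≡ zero → part v ≡ suc zero →
         col v ≢ next (col u) → NonAdj G u v
    W3 : ∀ u v → part u ≡ zero → part v ≡ suc zero →
         col v ≡ next (col u) → NonAdj G u v →
         ¬ InTriangle G u × ¬ InTriangle G v

{-# OPTIONS --safe #-}
module Submission where

-- Let P be the piece with two disjoint triangles T, T′ and Q the other one, let σ be the colour
-- shift along which (W2) allows edges from P to Q, and orient every triangle so that its vertices
-- x, y, z have colours X, σX, σ²X. By (W3) every vertex of a triangle in P is complete to the
-- σ-next colour class of Q, and prismaticity gives an edge x(T) y(T′) after possibly swapping
-- T and T′. For a triangle S in Q, every X-coloured vertex of Q other than x(S) misses y(S) or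
-- z(S); two such vertices missing the same one would be the isolated pair of an induced co-bridge
-- with C₄ x(T) y(T′) x(T′) y(S), resp. y(T) x(T) y(T′) z(S). So each colour class of Q has at
-- most 1 + 1 + 1 vertices.

open import Defs hiding (sym)
open import Data.Bool using (true; false)
open import Data.Bool.Properties using (¬-not) renaming (_≟_ to _≟ᵇ_)
open import Data.Empty using (⊥; ⊥-elim)
open import Data.Fin using (Fin)
open import Data.Fin.Patterns using (0F; 1F; 2F; 3F; 4F; 5F)
open import Data.Fin.Properties using (all?) renaming (_≟_ to _≟ᶠ_)
open import Data.List using (List; []; _∷_; length; filter; allFin)
open import Data.List.Relation.Unary.All using (All; []; _∷_)
open import Data.List.Relation.Unary.All.Properties using (all-filter)
open import Data.List.Relation.Unary.AllPairs using (_∷_)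
open import Data.List.Relation.Unary.Any using (here; there)
open import Data.List.Relation.Unary.Unique.Propositional using (Unique)
open import Data.List.Relation.Unary.Unique.Propositional.Properties using (filter⁺; allFin⁺)
open import Data.Nat using (ℕ; _+_; _≤_; z≤n; s≤s; _≤?_)
open import Data.Nat.Properties using (≤-trans; +-mono-≤; +-suc)
open import Data.Product using (Σ-syntax; _×_; _,_; proj₁; proj₂)
open import Data.Product.Properties using (≡-dec)
open import Data.List.Membership.DecPropositional {A = Fin 6 × Fin 6} (≡-dec _≟ᶠ_ _≟ᶠ_) using (_∈_; _∈?_)
open import Data.Sum using (_⊎_; inj₁; inj₂)
open import Data.Unit using (tt)
open import Function.Definitions using (Injective)
open import Relation.Binary.Definitions using (DecidableEquality)
open import Relation.Binary.PropositionalEquality using (_≡_; _≢_; refl; sym; trans; cong; subst; ≢-sym; module ≡-Reasoning)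
open import Relation.Nullary using (¬_; Dec; yes; no)
open import Relation.Nullary.Decidable using (map′; from-yes; ¬?; _×-dec_; _⊎-dec_; _→-dec_)
open import Relation.Unary using (Decidable)

_≟ᶜ_ : DecidableEquality Colour
A ≟ᶜ A = yes refl
A ≟ᶜ B = no λ ()
A ≟ᶜ C = no λ ()
B ≟ᶜ A = no λ ()
B ≟ᶜ B = yes refl
B ≟ᶜ C = no λ ()
C ≟ᶜ A = no λ ()
C ≟ᶜ B = no λ ()
C ≟ᶜ C = yes refl

all-colours? : {P : Colour → Set} → Decidable P → Dec (∀ X → P X)
all-colours? P? = map′ (λ (a , b , c) → λ { A → a ; B → b ; C → c }) (λ h → h A , h B , h C)
  (P? A ×-dec P? B ×-dec P? C)

three-colours-exhaust : ∀ X Y Z → X ≢ Y → X ≢ Z → Y ≢ Z → ∀ W → W ≡ X ⊎ W ≡ Y ⊎ W ≡ Z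
three-colours-exhaust = from-yes
  (all-colours? λ X → all-colours? λ Y → all-colours? λ Z →
    ¬? (X ≟ᶜ Y) →-dec ¬? (X ≟ᶜ Z) →-dec ¬? (Y ≟ᶜ Z) →-dec
    all-colours? λ W → W ≟ᶜ X ⊎-dec W ≟ᶜ Y ⊎-dec W ≟ᶜ Z)

next-≢ : ∀ X → next X ≢ X
next-≢ A ()
next-≢ B ()
next-≢ C ()

next²-≢ : ∀ X → next (next X) ≢ X
next²-≢ A ()
next²-≢ B ()
next²-≢ C ()

next³ : ∀ X → next (next (next X)) ≡ X
next³ A = refl
next³ B = refl
next³ C = refl

module _ {A : Set} where

  AtMostOne : (A → Set) → Set
  AtMostOne P = ∀ {a b} → P a → P b → a ≢ b → ⊥

  AtMost2 : (A → Set) → Set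
  AtMost2 P = ∀ {a b c} → P a → P b → P c → a ≢ b → a ≢ c → b ≢ c → ⊥

  AtMost3 : (A → Set) → Set
  AtMost3 P = ∀ {a b c d} → P a → P b → P c → P d →
    a ≢ b → a ≢ c → a ≢ d → b ≢ c → b ≢ d → c ≢ d → ⊥

  atMost2-∪ : {P L R : A → Set} → (∀ {a} → P a → L a ⊎ R a) →
    AtMostOne L → AtMostOne R → AtMost2 P
  atMost2-∪ split L≤1 R≤1 pa pb pc a≢b a≢c b≢c with split pa | split pb | split pc
  ... | inj₁ la | inj₁ lb | _      = L≤1 la lb a≢b
  ... | inj₂ ra | inj₂ rb | _      = R≤1 ra rb a≢b
  ... | inj₁ la | inj₂ _  | inj₁ lc = L≤1 la lc a≢c
  ... | inj₁ _  | inj₂ rb | inj₂ rc = R≤1 rb rc b≢c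
  ... | inj₂ ra | inj₁ _  | inj₂ rc = R≤1 ra rc a≢c
  ... | inj₂ _  | inj₁ lb | inj₁ lc = L≤1 lb lc b≢c

  atMost3-∖ : DecidableEquality A → {P : A → Set} (s : A) →
    AtMost2 (λ a → P a × a ≢ s) → AtMost3 P
  atMost3-∖ _≟_ s P∖s≤2 {a} {b} {c} pa pb pc pd a≢b a≢c a≢d b≢c b≢d c≢d
    with a ≟ s | b ≟ s | c ≟ s
  ... | yes refl | _ | _ =
    P∖s≤2 (pb , ≢-sym a≢b) (pc , ≢-sym a≢c) (pd , ≢-sym a≢d) b≢c b≢d c≢d
  ... | no a≢s | yes refl | _ =
    P∖s≤2 (pa , a≢s) (pc , ≢-sym b≢c) (pd , ≢-sym b≢d) a≢c a≢d c≢d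
  ... | no a≢s | no b≢s | yes refl =
    P∖s≤2 (pa , a≢s) (pb , b≢s) (pd , ≢-sym c≢d) a≢b a≢d b≢d
  ... | no a≢s | no b≢s | no c≢s =
    P∖s≤2 (pa , a≢s) (pb , b≢s) (pc , c≢s) a≢b a≢c b≢c

  atMost3⇒length≤3 : {P : A → Set} → AtMost3 P → ∀ {xs} → Unique xs → All P xs → length xs ≤ 3
  atMost3⇒length≤3 _ {[]} _ _ = z≤n
  atMost3⇒length≤3 _ {_ ∷ []} _ _ = s≤s z≤n
  atMost3⇒length≤3 _ {_ ∷ _ ∷ []} _ _ = s≤s (s≤s z≤n)
  atMost3⇒length≤3 _ {_ ∷ _ ∷ _ ∷ []} _ _ = s≤s (s≤s (s≤s z≤n))
  atMost3⇒length≤3 P≤3 {_ ∷ _ ∷ _ ∷ _ ∷ _}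
    ((a≢b ∷ a≢c ∷ a≢d ∷ _) ∷ (b≢c ∷ b≢d ∷ _) ∷ (c≢d ∷ _) ∷ _) (pa ∷ pb ∷ pc ∷ pd ∷ _) =
    ⊥-elim (P≤3 pa pb pc pd a≢b a≢c a≢d b≢c b≢d c≢d)

module _ {n : ℕ} (col : Fin n → Colour) {P : Fin n → Set} (P? : Decidable P) where

  coloured? : ∀ X → Decidable (λ v → P v × col v ≡ X)
  coloured? X v = P? v ×-dec col v ≟ᶜ X

  count-by-colour : ∀ xs → length (filter P? xs) ≤
    length (filter (coloured? A) xs) + length (filter (coloured? B) xs) + length (filter (coloured? C) xs)
  count-by-colour [] = z≤n
  count-by-colour (v ∷ xs) with P? v
  ... | no _ = count-by-colour xs
  ... | yes _ with col v
  ... | A = s≤s (count-by-colour xs)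
  ... | B rewrite +-suc (length (filter (coloured? A) xs)) (length (filter (coloured? B) xs)) =
    s≤s (count-by-colour xs)
  ... | C rewrite +-suc (length (filter (coloured? A) xs) + length (filter (coloured? B) xs))
                        (length (filter (coloured? C) xs)) =
    s≤s (count-by-colour xs)

  count≤3 : ∀ X → AtMost3 (λ v → P v × col v ≡ X) → length (filter (coloured? X) (allFin n)) ≤ 3
  count≤3 X ≤3 =
    atMost3⇒length≤3 ≤3 (filter⁺ (coloured? X) (allFin⁺ n)) (all-filter (coloured? X) (allFin n))

  colour-classes-atMost3⇒count≤9 : (∀ X → AtMost3 (λ v → P v × col v ≡ X)) →
    length (filter P? (allFin n)) ≤ 9
  colour-classes-atMost3⇒count≤9 ≤3 = ≤-trans (count-by-colour (allFin n))
    (+-mono-≤ (+-mono-≤ (count≤3 A (≤3 A)) (count≤3 B (≤3 B))) (count≤3 C (≤3 C)))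

module _ {A : Set} where

  OneOf : A → A → A → A → Set
  OneOf a b c t = t ≡ a ⊎ t ≡ b ⊎ t ≡ c

  Apart : A → A → A → A → Set
  Apart t a b c = t ≢ a × t ≢ b × t ≢ c

  apart-oneOf : ∀ {t a b c w} → Apart t a b c → OneOf a b c w → t ≢ w
  apart-oneOf (t≢a , _ , _) (inj₁ refl) = t≢a
  apart-oneOf (_ , t≢b , _) (inj₂ (inj₁ refl)) = t≢b
  apart-oneOf (_ , _ , t≢c) (inj₂ (inj₂ refl)) = t≢c

  oneOf-apart : ∀ {a₁ b₁ c₁ a₂ b₂ c₂ u w} →
    Apart a₁ a₂ b₂ c₂ × Apart b₁ a₂ b₂ c₂ × Apart c₁ a₂ b₂ c₂ →
    OneOf a₁ b₁ c₁ u → OneOf a₂ b₂ c₂ w → u ≢ w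
  oneOf-apart (a₁-apart , _ , _) (inj₁ refl) = apart-oneOf a₁-apart
  oneOf-apart (_ , b₁-apart , _) (inj₂ (inj₁ refl)) = apart-oneOf b₁-apart
  oneOf-apart (_ , _ , c₁-apart) (inj₂ (inj₂ refl)) = apart-oneOf c₁-apart

-- Only these pairs of distinct vertices of the co-bridge have equal rows in cobridgeAdj, so an
-- adjacency-preserving map from it is injective as soon as it separates them.
cobridgeTwins : List (Fin 6 × Fin 6)
cobridgeTwins = (0F , 2F) ∷ (2F , 0F) ∷ (1F , 3F) ∷ (3F , 1F) ∷ (4F , 5F) ∷ (5F , 4F) ∷ []

cobridge-twins : ∀ i j → (∀ k → cobridgeAdj i k ≡ cobridgeAdj j k) →
  i ≡ j ⊎ (i , j) ∈ cobridgeTwins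
cobridge-twins = from-yes (all? λ i → all? λ j →
  all? (λ k → cobridgeAdj i k ≟ᵇ cobridgeAdj j k) →-dec (i ≟ᶠ j ⊎-dec (i , j) ∈? cobridgeTwins))

module GraphProperties {n : ℕ} (G : Graph n) where

  adj-sym : ∀ {u v b} → adj G u v ≡ b → adj G v u ≡ b
  adj-sym {u} {v} = trans (Graph.sym G v u)

  ¬nonadj⇒adj : ∀ {u v} → ¬ NonAdj G u v → Adj G u v
  ¬nonadj⇒adj = ¬-not

  triangle-rotate : ∀ {a b c} → Triangle G a b c → Triangle G b c a
  triangle-rotate (_ , _ , _ , ab , bc , ac) = tt , tt , tt , bc , adj-sym ac , adj-sym ab

  triangle-swap : ∀ {a b c} → Triangle G a b c → Triangle G b a c
  triangle-swap (_ , _ , _ , ab , bc , ac) = tt , tt , tt , adj-sym ab , ac , bc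

  oneOf-R : ∀ {R a b c t} → TriangleIn G R a b c → OneOf a b c t → R t
  oneOf-R (ra , _ , _ , _) (inj₁ refl) = ra
  oneOf-R (_ , rb , _ , _) (inj₂ (inj₁ refl)) = rb
  oneOf-R (_ , _ , rc , _) (inj₂ (inj₂ refl)) = rc

  oneOf-adj : ∀ {R a b c t t'} → TriangleIn G R a b c →
    OneOf a b c t → OneOf a b c t' → t ≢ t' → Adj G t t'
  oneOf-adj _ (inj₁ refl) (inj₁ refl) t≢t = ⊥-elim (t≢t refl)
  oneOf-adj _ (inj₂ (inj₁ refl)) (inj₂ (inj₁ refl)) t≢t = ⊥-elim (t≢t refl)
  oneOf-adj _ (inj₂ (inj₂ refl)) (inj₂ (inj₂ refl)) t≢t = ⊥-elim (t≢t refl)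
  oneOf-adj (_ , _ , _ , ab , _ , _) (inj₁ refl) (inj₂ (inj₁ refl)) _ = ab
  oneOf-adj (_ , _ , _ , _ , _ , ac) (inj₁ refl) (inj₂ (inj₂ refl)) _ = ac
  oneOf-adj (_ , _ , _ , _ , bc , _) (inj₂ (inj₁ refl)) (inj₂ (inj₂ refl)) _ = bc
  oneOf-adj (_ , _ , _ , ab , _ , _) (inj₂ (inj₁ refl)) (inj₁ refl) _ = adj-sym ab
  oneOf-adj (_ , _ , _ , _ , _ , ac) (inj₂ (inj₂ refl)) (inj₁ refl) _ = adj-sym ac
  oneOf-adj (_ , _ , _ , _ , bc , _) (inj₂ (inj₂ refl)) (inj₂ (inj₁ refl)) _ = adj-sym bc

  module _ (prismatic : Prismatic G) {a b c v : Fin n}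
    (abc : Triangle G a b c) (v≢a : v ≢ a) (v≢b : v ≢ b) (v≢c : v ≢ c) where

    private
      one-neighbour : b2n G (adj G v a) + b2n G (adj G v b) + b2n G (adj G v c) ≡ 1
      one-neighbour = prismatic a b c abc v tt v≢a v≢b v≢c

      third-true : ∀ {x y z} → b2n G x + b2n G y + b2n G z ≡ 1 → x ≡ false → y ≡ false → z ≡ true
      third-true {false} {false} {true} _ refl refl = refl
      third-true {false} {false} {false} () refl refl
      third-true {true} _ () _
      third-true {false} {true} _ _ ()

      second-false : ∀ {x y z} → b2n G x + b2n G y + b2n G z ≡ 1 → x ≡ true → y ≡ false
      second-false {true} {false} _ refl = refl
      second-false {true} {true} () refl
      second-false {false} _ ()

    adjacent-to-third : NonAdj G v a → NonAdj G v b → Adj G v c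
    adjacent-to-third = third-true one-neighbour

    nonadjacent-to-second : Adj G v a → NonAdj G v b
    nonadjacent-to-second = second-false one-neighbour

  Anticomplete : Fin n → Fin n → Fin n → Fin n → Fin n → Set
  Anticomplete u c₀ c₁ c₂ c₃ = NonAdj G u c₀ × NonAdj G u c₁ × NonAdj G u c₂ × NonAdj G u c₃

  induced-cobridge : ∀ {c₀ c₁ c₂ c₃ u w} →
    Adj G c₀ c₁ → Adj G c₁ c₂ → Adj G c₂ c₃ → Adj G c₃ c₀ →
    NonAdj G c₀ c₂ → NonAdj G c₁ c₃ → c₀ ≢ c₂ → c₁ ≢ c₃ →
    Anticomplete u c₀ c₁ c₂ c₃ → Anticomplete w c₀ c₁ c₂ c₃ → NonAdj G u w → u ≢ w →
    HasInducedCobridge G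
  induced-cobridge {c₀} {c₁} {c₂} {c₃} {u} {w} e₀₁ e₁₂ e₂₃ e₃₀ n₀₂ n₁₃ c₀≢c₂ c₁≢c₃
    (u₀ , u₁ , u₂ , u₃) (w₀ , w₁ , w₂ , w₃) nᵤᵥ u≢w = f , f-injective , f-induces
    where
    f : Fin 6 → Fin n
    f 0F = c₀
    f 1F = c₁
    f 2F = c₂
    f 3F = c₃
    f 4F = u
    f 5F = w

    f-induces : ∀ i j → adj G (f i) (f j) ≡ cobridgeAdj i j
    f-induces 0F 0F = irrefl G c₀
    f-induces 0F 1F = e₀₁
    f-induces 0F 2F = n₀₂
    f-induces 0F 3F = adj-sym e₃₀
    f-induces 0F 4F = adj-sym u₀
    f-induces 0F 5F = adj-sym w₀
    f-induces 1F 0F = adj-sym e₀₁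
    f-induces 1F 1F = irrefl G c₁
    f-induces 1F 2F = e₁₂
    f-induces 1F 3F = n₁₃
    f-induces 1F 4F = adj-sym u₁
    f-induces 1F 5F = adj-sym w₁
    f-induces 2F 0F = adj-sym n₀₂
    f-induces 2F 1F = adj-sym e₁₂
    f-induces 2F 2F = irrefl G c₂
    f-induces 2F 3F = e₂₃
    f-induces 2F 4F = adj-sym u₂
    f-induces 2F 5F = adj-sym w₂
    f-induces 3F 0F = e₃₀
    f-induces 3F 1F = adj-sym n₁₃
    f-induces 3F 2F = adj-sym e₂₃
    f-induces 3F 3F = irrefl G c₃
    f-induces 3F 4F = adj-sym u₃
    f-induces 3F 5F = adj-sym w₃
    f-induces 4F 0F = u₀
    f-induces 4F 1F = u₁
    f-induces 4F 2F = u₂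
    f-induces 4F 3F = u₃
    f-induces 4F 4F = irrefl G u
    f-induces 4F 5F = nᵤᵥ
    f-induces 5F 0F = w₀
    f-induces 5F 1F = w₁
    f-induces 5F 2F = w₂
    f-induces 5F 3F = w₃
    f-induces 5F 4F = adj-sym nᵤᵥ
    f-induces 5F 5F = irrefl G w

    same-row : ∀ {i j} → f i ≡ f j → ∀ k → cobridgeAdj i k ≡ cobridgeAdj j k
    same-row {i} {j} fi≡fj k = begin
      cobridgeAdj i k    ≡⟨ sym (f-induces i k) ⟩
      adj G (f i) (f k)  ≡⟨ cong (λ v → adj G v (f k)) fi≡fj ⟩
      adj G (f j) (f k)  ≡⟨ f-induces j k ⟩
      cobridgeAdj j k    ∎
      where open ≡-Reasoning

    f-injective : Injective _≡_ _≡_ f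
    f-injective {i} {j} fi≡fj with cobridge-twins i j (same-row fi≡fj)
    ... | inj₁ i≡j = i≡j
    ... | inj₂ (here refl) = ⊥-elim (c₀≢c₂ fi≡fj)
    ... | inj₂ (there (here refl)) = ⊥-elim (c₀≢c₂ (sym fi≡fj))
    ... | inj₂ (there (there (here refl))) = ⊥-elim (c₁≢c₃ fi≡fj)
    ... | inj₂ (there (there (there (here refl)))) = ⊥-elim (c₁≢c₃ (sym fi≡fj))
    ... | inj₂ (there (there (there (there (here refl))))) = ⊥-elim (u≢w fi≡fj)
    ... | inj₂ (there (there (there (there (there (here refl)))))) = ⊥-elim (u≢w (sym fi≡fj))

-- (W2) and (W3) between two pieces P and Q: σ is next when P is the first piece and
-- next ∘ next when it is the second.
record Linked {n : ℕ} (G : Graph n) (col : Fin n → Colour) (σ : Colour → Colour)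
  (P Q : Fin n → Set) : Set where
  field
    σ-≢         : ∀ X → σ X ≢ X
    σ²-≢        : ∀ X → σ (σ X) ≢ X
    disjoint    : ∀ {v} → P v → Q v → ⊥
    nonadjacent : ∀ {u v} → P u → Q v → col v ≢ σ (col u) → NonAdj G u v
    adjacent    : ∀ {u v} → P u → Q v → col v ≡ σ (col u) → InTriangle G u → Adj G u v

module TwoPieces {n : ℕ} {G : Graph n} (prismatic : Prismatic G) (cobridge-free : CobridgeFree G)
  {col : Fin n → Colour} (colouring : Is3Colouring G col)
  {σ : Colour → Colour} {P Q : Fin n → Set} (linked : Linked G col σ P Q) where

  open GraphProperties G
  open Linked linked

  X≢σX : ∀ X → X ≢ σ X
  X≢σX X = ≢-sym (σ-≢ X)

  X≢σ²X : ∀ X → X ≢ σ (σ X)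
  X≢σ²X X = ≢-sym (σ²-≢ X)

  σX≢σ²X : ∀ X → σ X ≢ σ (σ X)
  σX≢σ²X X = ≢-sym (σ-≢ (σ X))

  coloured-≢ : ∀ {u v X Y} → col u ≡ X → col v ≡ Y → X ≢ Y → u ≢ v
  coloured-≢ refl refl X≢Y refl = X≢Y refl

  coloured-nonadj : ∀ {u v X} → col u ≡ X → col v ≡ X → NonAdj G u v
  coloured-nonadj {u} {v} refl cv = ¬-not λ uv → colouring u v uv (sym cv)

  linked-nonadj : ∀ {u v X Y} → P u → Q v → col u ≡ X → col v ≡ Y → Y ≢ σ X → NonAdj G u v
  linked-nonadj pu qv refl refl = nonadjacent pu qv

  record ColouredTriangle (R : Fin n → Set) (X : Colour) : Set where
    field
      x y z    : Fin n
      x∈R      : R x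
      y∈R      : R y
      z∈R      : R z
      col-x    : col x ≡ X
      col-y    : col y ≡ σ X
      col-z    : col z ≡ σ (σ X)
      x-y      : Adj G x y
      y-z      : Adj G y z
      x-z      : Adj G x z

    triangle : Triangle G x y z
    triangle = tt , tt , tt , x-y , y-z , x-z

  open ColouredTriangle

  Disjoint : ∀ {R R' X} → ColouredTriangle R X → ColouredTriangle R' X → Set
  Disjoint T T' = x T ≢ x T' × y T ≢ y T' × z T ≢ z T'

  disjoint-sym : ∀ {R R' X} (T : ColouredTriangle R X) (T' : ColouredTriangle R' X) →
    Disjoint T T' → Disjoint T' T
  disjoint-sym _ _ (x≢x' , y≢y' , z≢z') = ≢-sym x≢x' , ≢-sym y≢y' , ≢-sym z≢z'

  module _ {R : Fin n → Set} {a b c : Fin n} where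

    vertex-of-colour : TriangleIn G R a b c → ∀ W → Σ[ t ∈ Fin n ] OneOf a b c t × col t ≡ W
    vertex-of-colour (_ , _ , _ , ab , bc , ac) W
      with three-colours-exhaust (col a) (col b) (col c)
             (colouring a b ab) (colouring a c ac) (colouring b c bc) W
    ... | inj₁ W≡a = a , inj₁ refl , sym W≡a
    ... | inj₂ (inj₁ W≡b) = b , inj₂ (inj₁ refl) , sym W≡b
    ... | inj₂ (inj₂ W≡c) = c , inj₂ (inj₂ refl) , sym W≡c

    orient : TriangleIn G R a b c → ∀ X →
      Σ[ T ∈ ColouredTriangle R X ] OneOf a b c (x T) × OneOf a b c (y T) × OneOf a b c (z T)
    orient abc X
      with vertex-of-colour abc X | vertex-of-colour abc (σ X) | vertex-of-colour abc (σ (σ X))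
    ... | u , u∈ , cu | v , v∈ , cv | w , w∈ , cw = T , u∈ , v∈ , w∈
      where
      T : ColouredTriangle R X
      T = record
        { x = u ; y = v ; z = w
        ; x∈R = oneOf-R abc u∈ ; y∈R = oneOf-R abc v∈ ; z∈R = oneOf-R abc w∈
        ; col-x = cu ; col-y = cv ; col-z = cw
        ; x-y = oneOf-adj abc u∈ v∈ (coloured-≢ cu cv (X≢σX X))
        ; y-z = oneOf-adj abc v∈ w∈ (coloured-≢ cv cw (σX≢σ²X X))
        ; x-z = oneOf-adj abc u∈ w∈ (coloured-≢ cu cw (X≢σ²X X))
        }

  disjoint-coloured-triangles : TwoDisjointTrianglesIn G P → ∀ X →
    Σ[ T₁ ∈ ColouredTriangle P X ] Σ[ T₂ ∈ ColouredTriangle P X ] Disjoint T₁ T₂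
  disjoint-coloured-triangles (_ , _ , _ , _ , _ , _ , t₁ , t₂ , apart) X
    with orient t₁ X | orient t₂ X
  ... | T₁ , x₁ , y₁ , z₁ | T₂ , x₂ , y₂ , z₂ =
    T₁ , T₂ , oneOf-apart apart x₁ x₂ , oneOf-apart apart y₁ y₂ , oneOf-apart apart z₁ z₂

  x-adj : ∀ {X v} (T : ColouredTriangle P X) → Q v → col v ≡ σ X → Adj G (x T) v
  x-adj T qv cv =
    adjacent (x∈R T) qv (trans cv (cong σ (sym (col-x T)))) (y T , z T , triangle T)

  y-adj : ∀ {X v} (T : ColouredTriangle P X) → Q v → col v ≡ σ (σ X) → Adj G (y T) v
  y-adj T qv cv =
    adjacent (y∈R T) qv (trans cv (cong σ (sym (col-y T)))) (x T , z T , triangle-swap (triangle T))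

  crossing-edge : ∀ {X} (T₁ T₂ : ColouredTriangle P X) → Disjoint T₁ T₂ →
    Adj G (x T₁) (y T₂) ⊎ Adj G (x T₂) (y T₁)
  crossing-edge T₁ T₂ (x₁≢x₂ , y₁≢y₂ , z₁≢z₂) with adj G (x T₁) (y T₂) in x₁y₂
  ... | true = inj₁ refl
  ... | false = inj₂ (adj-sym y₁x₂)
    where
    x₁z₂ : Adj G (x T₁) (z T₂)
    x₁z₂ = adjacent-to-third prismatic (triangle T₂) x₁≢x₂
      (coloured-≢ (col-x T₁) (col-y T₂) (X≢σX _)) (coloured-≢ (col-x T₁) (col-z T₂) (X≢σ²X _))
      (coloured-nonadj (col-x T₁) (col-x T₂)) x₁y₂
    z₂y₁ : NonAdj G (z T₂) (y T₁)
    z₂y₁ = nonadjacent-to-second prismatic (triangle T₁)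
      (coloured-≢ (col-z T₂) (col-x T₁) (σ²-≢ _))
      (coloured-≢ (col-z T₂) (col-y T₁) (≢-sym (σX≢σ²X _)))
      (≢-sym z₁≢z₂) (adj-sym x₁z₂)
    y₁x₂ : Adj G (y T₁) (x T₂)
    y₁x₂ = adjacent-to-third prismatic (triangle-rotate (triangle T₂)) y₁≢y₂
      (coloured-≢ (col-y T₁) (col-z T₂) (σX≢σ²X _)) (coloured-≢ (col-y T₁) (col-x T₂) (σ-≢ _))
      (coloured-nonadj (col-y T₁) (col-y T₂)) (adj-sym z₂y₁)

  ColourClass : Colour → Fin n → Set
  ColourClass X u = Q u × col u ≡ X

  misses-y-or-z : ∀ {X} (S : ColouredTriangle Q X) {u} → ColourClass X u × u ≢ x S →
    (ColourClass X u × NonAdj G u (y S)) ⊎ (ColourClass X u × NonAdj G u (z S))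
  misses-y-or-z S {u} ((qu , cu) , u≢x) with adj G u (y S) in uy
  ... | false = inj₁ ((qu , cu) , refl)
  ... | true = inj₂ ((qu , cu) , nonadjacent-to-second prismatic (triangle-rotate (triangle S))
    (coloured-≢ cu (col-y S) (X≢σX _)) (coloured-≢ cu (col-z S) (X≢σ²X _)) u≢x uy)

  module _ {X} (T T' : ColouredTriangle P X) (T-T' : Disjoint T T') (xy' : Adj G (x T) (y T'))
    (S : ColouredTriangle Q X) where

    missing-y-atMostOne : AtMostOne (λ u → ColourClass X u × NonAdj G u (y S))
    missing-y-atMostOne ((qu , cu) , uy) ((qw , cw) , wy) u≢w = cobridge-free
      (induced-cobridge
        xy' (adj-sym (x-y T')) (x-adj T' (y∈R S) (col-y S)) (adj-sym (x-adj T (y∈R S) (col-y S)))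
        (coloured-nonadj (col-x T) (col-x T')) (coloured-nonadj (col-y T') (col-y S))
        (proj₁ T-T') (λ y'≡yS → disjoint (y∈R T') (subst Q (sym y'≡yS) (y∈R S)))
        (anticomplete qu cu uy) (anticomplete qw cw wy) (coloured-nonadj cu cw) u≢w)
      where
      anticomplete : ∀ {v} → Q v → col v ≡ X → NonAdj G v (y S) →
        Anticomplete v (x T) (y T') (x T') (y S)
      anticomplete qv cv vy = coloured-nonadj cv (col-x T)
        , adj-sym (linked-nonadj (y∈R T') qv (col-y T') cv (X≢σ²X X))
        , coloured-nonadj cv (col-x T') , vy

    missing-z-atMostOne : AtMostOne (λ u → ColourClass X u × NonAdj G u (z S))
    missing-z-atMostOne ((qu , cu) , uz) ((qw , cw) , wz) u≢w = cobridge-free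
      (induced-cobridge
        (adj-sym (x-y T)) xy' (y-adj T' (z∈R S) (col-z S)) (adj-sym (y-adj T (z∈R S) (col-z S)))
        (coloured-nonadj (col-y T) (col-y T'))
        (linked-nonadj (x∈R T) (z∈R S) (col-x T) (col-z S) (≢-sym (σX≢σ²X X)))
        (proj₁ (proj₂ T-T')) (coloured-≢ (col-x T) (col-z S) (X≢σ²X X))
        (anticomplete qu cu uz) (anticomplete qw cw wz) (coloured-nonadj cu cw) u≢w)
      where
      anticomplete : ∀ {v} → Q v → col v ≡ X → NonAdj G v (z S) →
        Anticomplete v (y T) (x T) (y T') (z S)
      anticomplete qv cv vz = adj-sym (linked-nonadj (y∈R T) qv (col-y T) cv (X≢σ²X X))
        , coloured-nonadj cv (col-x T)
        , adj-sym (linked-nonadj (y∈R T') qv (col-y T') cv (X≢σ²X X)) , vz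

    colour-class-atMost3 : AtMost3 (ColourClass X)
    colour-class-atMost3 = atMost3-∖ _≟ᶠ_ (x S)
      (atMost2-∪ (misses-y-or-z S) missing-y-atMostOne missing-z-atMostOne)

  colour-classes-atMost3 : TwoDisjointTrianglesIn G P → HasTriangleIn G Q →
    ∀ X → AtMost3 (ColourClass X)
  colour-classes-atMost3 two-triangles (_ , _ , _ , abc) X
    with disjoint-coloured-triangles two-triangles X | orient abc X
  ... | T₁ , T₂ , T₁-T₂ | S , _ with crossing-edge T₁ T₂ T₁-T₂
  ... | inj₁ x₁y₂ = colour-class-atMost3 T₁ T₂ T₁-T₂ x₁y₂ S
  ... | inj₂ x₂y₁ = colour-class-atMost3 T₂ T₁ (disjoint-sym T₁ T₂ T₁-T₂) x₂y₁ S

module _ {n : ℕ} {G : Graph n} {col : Fin n → Colour} {part : Fin n → Fin 2}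
  (chain : Worn2Chain G col part) where

  open Worn2Chain chain
  open GraphProperties G

  private
    pieces-disjoint : ∀ {v} → part v ≡ 0F → part v ≡ 1F → ⊥
    pieces-disjoint p0 p1 with trans (sym p0) p1
    ... | ()

  first-linked-to-second : Linked G col next (λ v → part v ≡ 0F) (λ v → part v ≡ 1F)
  first-linked-to-second = record
    { σ-≢ = next-≢
    ; σ²-≢ = next²-≢
    ; disjoint = pieces-disjoint
    ; nonadjacent = W2 _ _
    ; adjacent = λ pu pv cv u-in-triangle →
        ¬nonadj⇒adj λ uv → proj₁ (W3 _ _ pu pv cv uv) u-in-triangle
    }

  second-linked-to-first : Linked G col (λ X → next (next X)) (λ v → part v ≡ 1F) (λ v → part v ≡ 0F)
  second-linked-to-first = record
    { σ-≢ = next²-≢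
    ; σ²-≢ = λ X next⁴X≡X → next-≢ X (trans (sym (next³ (next X))) next⁴X≡X)
    ; disjoint = λ p1 p0 → pieces-disjoint p0 p1
    ; nonadjacent = λ pu pv cv≢ → adj-sym (W2 _ _ pv pu λ cu≡ → cv≢ (backward cu≡))
    ; adjacent = λ pu pv cv u-in-triangle →
        ¬nonadj⇒adj λ uv → proj₂ (W3 _ _ pv pu (forward cv) (adj-sym uv)) u-in-triangle
    }
    where
    backward : ∀ {X Y} → X ≡ next Y → Y ≡ next (next X)
    backward {Y = Y} refl = sym (next³ Y)
    forward : ∀ {X Y} → X ≡ next (next Y) → Y ≡ next X
    forward {Y = Y} refl = sym (next³ Y)

lemma4p8 : {n : ℕ} (G : Graph n) → Prismatic G → CobridgeFree G →
    (col : Fin n → Colour) → Is3Colouring G col →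
    (part : Fin n → Fin 2) → Worn2Chain G col part →
    (i j : Fin 2) → i ≢ j →
    TwoDisjointTrianglesIn G (λ v → part v ≡ i) →
    pieceSize part j ≤ 9 ⊎ ¬ HasTriangleIn G (λ v → part v ≡ j)
lemma4p8 G prismatic cobridge-free col colouring part chain i j i≢j two-triangles
  with pieceSize part j ≤? 9
... | yes small = inj₁ small
... | no large = inj₂ λ triangle →
  large (colour-classes-atMost3⇒count≤9 col (λ v → part v ≟ᶠ j)
    (colour-classes i j i≢j two-triangles triangle))
  where
  colour-classes : ∀ i j → i ≢ j → TwoDisjointTrianglesIn G (λ v → part v ≡ i) →
    HasTriangleIn G (λ v → part v ≡ j) → ∀ X → AtMost3 (λ v → part v ≡ j × col v ≡ X)
  colour-classes 0F 0F 0≢0 = ⊥-elim (0≢0 refl)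
  colour-classes 1F 1F 1≢1 = ⊥-elim (1≢1 refl)
  colour-classes 0F 1F _ = TwoPieces.colour-classes-atMost3 prismatic cobridge-free colouring
    (first-linked-to-second chain)
  colour-classes 1F 0F _ = TwoPieces.colour-classes-atMost3 prismatic cobridge-free colouring
    (second-linked-to-first chain)
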